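{- Let $s_2$ be a binary string with $|s_2|\ge3$, $s_2\ne100$, and $S=\{100,s_2\}$. The Seeker wins the Renyi-Ulam game with lie restriction $r(S)$ if and only if $s_2\in R_\#$.
   Context: $R_\#$ is the set of binary strings containing no substring $01^k0$ with $k=0$ or $k\ge2$ ($1^k$ denotes $k$ consecutive $1$s); explicitly $R_\#=\{1^a w 1^c: a,c\ge0,\ w \text{ empty or } w=(01)^j0,\ j\ge0\}$. For a set $S$ of nonempty binary strings, $r(S)$ is the set of finite binary strings containing no element of $S$ as a contiguous substring. Renyi-Ulam game with lie restriction $R$: the Obscurer picks $x\in\{1,\dots,n\}$; each turn the Seeker asks whether $x$ lies in a chosen subset and the Obscurer answers yes or no. The lie pattern of a candidate $y$ is the binary string whose $i$-th bit is $1$ iff the $i$-th answer is false for $y$; the Obscurer's answers must keep her number's lie pattern in $R$. The Seeker wins for $n$ if he has an adaptive strategy guaranteeing after finitely many questions that at most one $y\in\{1,\dots,n\}$ has lie pattern in $R$; "the Seeker wins" means he wins for every $n\ge1$. -}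

module Defs where

open import Data.Bool using (Bool; true; false; _xor_)
open import Data.Nat using (ℕ; _≤_)
open import Data.List using (List; []; _∷_; _++_; [_]; replicate)
open import Data.List.Relation.Binary.Infix.Heterogeneous using (Infix)
open import Data.Fin using (Fin)
open import Data.Product using (_×_)
open import Data.Sum using (_⊎_)
open import Relation.Binary.PropositionalEquality using (_≡_)
open import Relation.Nullary using (¬_)

-- Binary strings: bit 1 = true, bit 0 = false.
BinStr : Set
BinStr = List Bool

_⊑_ : BinStr → BinStr → Set
u ⊑ w = Infix _≡_ u w

s100 : BinStr
s100 = true ∷ false ∷ false ∷ []

rS : BinStr → BinStr → Set
rS s2 w = ¬ (s100 ⊑ w) × ¬ (s2 ⊑ w)

R♯ : BinStr → Set
R♯ w = ∀ (k : ℕ) → (k ≡ 0 ⊎ 2 ≤ k) → ¬ ((false ∷ replicate k true ++ [ false ]) ⊑ w)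

AtMostOne : ∀ {n} → (Fin n → Set) → Set
AtMostOne {n} P = ∀ (y z : Fin n) → P y → P z → y ≡ z

-- Lie bit of candidate y when the question is the subset Q and the answer is a
-- (true = "yes"): 1 iff the answer is false for y, i.e. iff Q y ≠ a.
lieBit : ∀ {n} → (Fin n → Bool) → Bool → Fin n → Bool
lieBit Q a y = Q y xor a

-- Wins R σ : from the position where candidate y has lie pattern σ y,
-- the Seeker has an adaptive strategy (a finite, well-founded game tree,
-- the Obscurer choosing every answer adversarially) reaching a position
-- where at most one candidate has lie pattern in R.
data Wins (R : BinStr → Set) {n : ℕ} : (Fin n → BinStr) → Set where
  done : ∀ {σ} → AtMostOne (λ y → R (σ y)) → Wins R σ
  ask  : ∀ {σ} (Q : Fin n → Bool) →
         ((a : Bool) → Wins R (λ y → σ y ++ [ lieBit Q a y ])) →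
         Wins R σ

SeekerWinsFor : (BinStr → Set) → ℕ → Set
SeekerWinsFor R n = Wins R {n} (λ _ → [])

SeekerWins : (BinStr → Set) → Set
SeekerWins R = ∀ (n : ℕ) → 1 ≤ n → SeekerWinsFor R n

-- Lie patterns only grow, so the Seeker wins as soon as, for any two candidates, he can force
-- the pattern of one of them to contain 100 or s2.  Asking only ∅ and {p}, he writes a word
-- of R♯ = {1ᵃ(01)ʲ01ᶜ} ∪ {1ᵐ} letter by letter at the end of one candidate's pattern: every
-- deviation of the Obscurer puts 100 into one of the two patterns.  Conversely, if s2
-- contains 01ᵏ0 with k ≠ 1, the Obscurer keeps two candidates alive for ever: when a question
-- treats them alike she lies to both, otherwise she lies to the one whose newest run of ones
-- is neither empty nor of length k; bookkeeping of the two runs shows such a choice always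
-- remains possible.

module Submission where

open import Defs
open import Data.Bool using (Bool; true; false; not; _xor_)
open import Data.Empty using (⊥-elim)
open import Data.Fin using (Fin; zero; suc) renaming (_≟_ to _≟ᶠ_)
open import Data.List
  using (List; []; _∷_; _++_; [_]; replicate; reverse; length; allFin; cartesianProduct)
open import Data.List.Properties
  using (++-assoc; ++-identityʳ; reverse-++; reverse-involutive; unfold-reverse)
open import Data.List.Membership.Propositional.Properties using (∈-allFin; ∈-cartesianProduct⁺)
import Data.List.Relation.Binary.Infix.Heterogeneous.Properties as Infix
open import Data.List.Relation.Binary.Infix.Heterogeneous using (here; there; _ⁱ++_)
import Data.List.Relation.Binary.Pointwise as Pointwise
open import Data.List.Relation.Binary.Prefix.Heterogeneous using (Prefix; []; _∷_; _++ᵖ_)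
import Data.List.Relation.Binary.Prefix.Heterogeneous.Properties as Prefix
import Data.List.Relation.Binary.Suffix.Heterogeneous.Properties as Suffix
open import Data.List.Relation.Unary.All as All using (All; []; _∷_)
open import Data.Nat using (ℕ; zero; suc; _≤_; z≤n; s≤s)
open import Data.Nat.Properties using (_≟_; suc-injective; 1+n≢n; m≤n⇒m≤1+n; >⇒≢)
open import Data.Product using (_×_; _,_; proj₁; proj₂; Σ; ∃; ∃₂)
open import Data.Sum as Sum using (_⊎_; inj₁; inj₂; [_,_]′)
open import Data.Unit using (⊤; tt)
open import Relation.Binary.PropositionalEquality
  using (_≡_; _≢_; refl; sym; trans; cong; subst; subst₂; ≢-sym; module ≡-Reasoning)
open import Relation.Nullary using (¬_; yes; no; does)
open import Relation.Nullary.Decidable using (dec-true; dec-false)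

private
  variable
    n : ℕ
    b : Bool
    u v w x : BinStr

replicate-++-∷ : ∀ m (c : Bool) u → replicate m c ++ c ∷ u ≡ c ∷ replicate m c ++ u
replicate-++-∷ zero    c u = refl
replicate-++-∷ (suc m) c u = cong (c ∷_) (replicate-++-∷ m c u)

reverse-∷ʳ : ∀ (w : BinStr) b → reverse (w ++ [ b ]) ≡ b ∷ reverse w
reverse-∷ʳ w b = reverse-++ w [ b ]

reverse-replicate : ∀ m (c : Bool) → reverse (replicate m c) ≡ replicate m c
reverse-replicate zero    c = refl
reverse-replicate (suc m) c = begin
  reverse (c ∷ replicate m c)     ≡⟨ unfold-reverse c (replicate m c) ⟩
  reverse (replicate m c) ++ [ c ] ≡⟨ cong (_++ [ c ]) (reverse-replicate m c) ⟩
  replicate m c ++ [ c ]           ≡⟨ replicate-++-∷ m c [] ⟩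
  c ∷ replicate m c ++ []          ≡⟨ cong (c ∷_) (++-identityʳ _) ⟩
  replicate (suc m) c              ∎
  where open ≡-Reasoning

01ᵏ0 : ℕ → BinStr
01ᵏ0 k = false ∷ replicate k true ++ [ false ]

reverse-01ᵏ0 : ∀ k → reverse (01ᵏ0 k) ≡ 01ᵏ0 k
reverse-01ᵏ0 k = begin
  reverse (false ∷ 1ᵏ0)        ≡⟨ unfold-reverse false 1ᵏ0 ⟩
  reverse 1ᵏ0 ++ [ false ]     ≡⟨ cong (_++ [ false ]) (reverse-∷ʳ (replicate k true) false) ⟩
  false ∷ reverse 1ᵏ ++ [ false ]
    ≡⟨ cong (λ t → false ∷ t ++ [ false ]) (reverse-replicate k true) ⟩
  01ᵏ0 k                       ∎
  where
  open ≡-Reasoning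
  1ᵏ  = replicate k true
  1ᵏ0 = 1ᵏ ++ [ false ]

prefix-++ : ∀ (x s : BinStr) → Prefix _≡_ x (x ++ s)
prefix-++ x s = Prefix.fromPointwise (Pointwise.refl refl) ++ᵖ s

⊑-reverse⁺ : x ⊑ w → reverse x ⊑ reverse w
⊑-reverse⁺ (here p) = Infix.fromSuffix (Suffix.fromPrefix p)
⊑-reverse⁺ {x} {c ∷ w} (there i) =
  subst (reverse x ⊑_) (sym (unfold-reverse c w)) (⊑-reverse⁺ i ⁱ++ [ c ])

⊑-reverse⁻ : reverse x ⊑ reverse w → x ⊑ w
⊑-reverse⁻ {x} {w} i = subst₂ _⊑_ (reverse-involutive x) (reverse-involutive w) (⊑-reverse⁺ i)

⊑-∷⁺ : ¬ Prefix _≡_ x (b ∷ w) → ¬ x ⊑ w → ¬ x ⊑ (b ∷ w)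
⊑-∷⁺ ¬p ¬i i = [ ¬p , ¬i ]′ (Infix.∷⁻ i)

¬Prefix-1ᵏ0-1ᵐ : ∀ k m → ¬ Prefix _≡_ (replicate k true ++ [ false ]) (replicate m true)
¬Prefix-1ᵏ0-1ᵐ zero    (suc m) (() ∷ _)
¬Prefix-1ᵏ0-1ᵐ (suc k) (suc m) (_ ∷ p) = ¬Prefix-1ᵏ0-1ᵐ k m p

¬Prefix-1ᵏ0-1ʲ0 : ∀ {k j} rest → j ≢ k →
                  ¬ Prefix _≡_ (replicate k true ++ [ false ]) (replicate j true ++ false ∷ rest)
¬Prefix-1ᵏ0-1ʲ0 {zero}  {zero}  rest j≢k _        = j≢k refl
¬Prefix-1ᵏ0-1ʲ0 {zero}  {suc j} rest j≢k (() ∷ _)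
¬Prefix-1ᵏ0-1ʲ0 {suc k} {zero}  rest j≢k (() ∷ _)
¬Prefix-1ᵏ0-1ʲ0 {suc k} {suc j} rest j≢k (_ ∷ p) = ¬Prefix-1ᵏ0-1ʲ0 rest (λ e → j≢k (cong suc e)) p

cycle01 : ℕ → BinStr
cycle01 zero    = []
cycle01 (suc j) = false ∷ true ∷ cycle01 j

data R♯Form : BinStr → Set where
  ones     : ∀ m → R♯Form (replicate m true)
  withZero : ∀ P j Q → R♯Form (replicate P true ++ cycle01 j ++ false ∷ replicate Q true)

R♯-∷ : R♯ (b ∷ w) → R♯ w
R♯-∷ h k k≢1 i = h k k≢1 (there i)

R♯-reverse : R♯ w → R♯ (reverse w)
R♯-reverse {w} h k k≢1 i =
  h k k≢1 (⊑-reverse⁻ (subst (_⊑ reverse w) (sym (reverse-01ᵏ0 k)) i))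

only-ones-after-01ᵏ : ∀ k t → 2 ≤ k → R♯ (false ∷ replicate k true ++ t) →
                      ∃ λ m → t ≡ replicate m true
only-ones-after-01ᵏ k []          _   _ = 0 , refl
only-ones-after-01ᵏ k (true ∷ t)  2≤k h
  with m , refl ← only-ones-after-01ᵏ (suc k) t (m≤n⇒m≤1+n 2≤k)
                    (subst (λ s → R♯ (false ∷ s)) (replicate-++-∷ k true t) h)
  = suc m , refl
only-ones-after-01ᵏ k (false ∷ t) 2≤k h =
  ⊥-elim (h k (inj₂ 2≤k) (here (Prefix.++⁺ {as = false ∷ replicate k true}
                                            (Pointwise.refl refl) (refl ∷ []))))

R♯-from-zero : ∀ w → R♯ (false ∷ w) →
               ∃₂ λ j Q → false ∷ w ≡ cycle01 j ++ false ∷ replicate Q true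
R♯-from-zero []                 h = 0 , 0 , refl
R♯-from-zero (false ∷ w)        h = ⊥-elim (h 0 (inj₁ refl) (here (refl ∷ refl ∷ [])))
R♯-from-zero (true ∷ [])        h = 0 , 1 , refl
R♯-from-zero (true ∷ true ∷ t)  h with m , refl ← only-ones-after-01ᵏ 2 t (s≤s (s≤s z≤n)) h
  = 0 , suc (suc m) , refl
R♯-from-zero (true ∷ false ∷ t) h with j , Q , e ← R♯-from-zero t (R♯-∷ (R♯-∷ h))
  = suc j , Q , cong (λ s → false ∷ true ∷ s) e

R♯-form : ∀ w → R♯ w → R♯Form w
R♯-form []          h = ones 0
R♯-form (true ∷ w)  h with R♯-form w (R♯-∷ h)
... | ones m         = ones (suc m)
... | withZero P j Q = withZero (suc P) j Q
R♯-form (false ∷ w) h with j , Q , e ← R♯-from-zero w h = subst R♯Form (sym e) (withZero 0 j Q)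

-- Seeker strategies

History : ℕ → Set
History n = Fin n → BinStr

extend : History n → (Fin n → Bool) → Bool → History n
extend σ Q a y = σ y ++ [ lieBit Q a y ]

data Reach {n} (G : History n → Set) : History n → Set where
  stop : ∀ {σ} → G σ → Reach G σ
  ask  : ∀ {σ} (Q : Fin n → Bool) → ((a : Bool) → Reach G (extend σ Q a)) → Reach G σ

Upward : (History n → Set) → Set
Upward G = ∀ {σ} Q a → G σ → G (extend σ Q a)

reach-bind : ∀ {G H : History n → Set} {σ} → Reach G σ → (∀ {σ} → G σ → Reach H σ) → Reach H σ
reach-bind (stop g)     k = k g
reach-bind (ask Q next) k = ask Q (λ a → reach-bind (next a) k)

reach-map : ∀ {G H : History n → Set} {σ} → (∀ {σ} → G σ → H σ) → Reach G σ → Reach H σ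
reach-map f r = reach-bind r (λ g → stop (f g))

-- An upward G, once reached, survives the rest of the play; so reach G first and H afterwards.
reach-× : ∀ {G H : History n → Set} → Upward G → (∀ σ → Reach G σ) → (∀ σ → Reach H σ) →
          ∀ σ → Reach (λ σ → G σ × H σ) σ
reach-× {G = G} {H} up reachG reachH σ = reach-bind (reachG σ) (λ g → keep g (reachH _))
  where
  keep : ∀ {σ} → G σ → Reach H σ → Reach (λ σ → G σ × H σ) σ
  keep g (stop h)     = stop (g , h)
  keep g (ask Q next) = ask Q (λ a → keep (up Q a g) (next a))

reach-All : ∀ {A : Set} {P : A → History n → Set} → (∀ x → Upward (P x)) →
            (∀ x σ → Reach (P x) σ) → ∀ xs σ → Reach (λ σ → All (λ x → P x σ) xs) σ
reach-All up reach []       σ = stop []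
reach-All up reach (x ∷ xs) σ =
  reach-map (λ (p , ps) → p ∷ ps) (reach-× (up x) (reach x) (reach-All up reach xs) σ)

PrefixClosed : (BinStr → Set) → Set
PrefixClosed R = ∀ {w} b → R (w ++ [ b ]) → R w

Separated : (BinStr → Set) → Fin n → Fin n → History n → Set
Separated R y z σ = ¬ R (σ y) ⊎ ¬ R (σ z)

wins-of-reach : ∀ {R} {σ : History n} → Reach (λ σ → AtMostOne (λ y → R (σ y))) σ → Wins R σ
wins-of-reach (stop g)     = done g
wins-of-reach (ask Q next) = ask Q (λ a → wins-of-reach (next a))

seekerWinsFor-if-separating : ∀ {R} → PrefixClosed R →
  (∀ (y z : Fin n) → y ≢ z → ∀ σ → Reach (Separated R y z) σ) → SeekerWinsFor R n
seekerWinsFor-if-separating {n} {R} closed separate =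
  wins-of-reach (reach-map atMostOne (reach-All upward separate′ pairs _))
  where
  pairs : List (Fin n × Fin n)
  pairs = cartesianProduct (allFin n) (allFin n)

  P : Fin n × Fin n → History n → Set
  P (y , z) σ = y ≢ z → Separated R y z σ

  upward : ∀ yz → Upward (P yz)
  upward yz Q a s y≢z = Sum.map (λ ¬r r → ¬r (closed _ r)) (λ ¬r r → ¬r (closed _ r)) (s y≢z)

  separate′ : ∀ yz σ → Reach (P yz) σ
  separate′ (y , z) σ with y ≟ᶠ z
  ... | yes y≡z = stop (λ y≢z → ⊥-elim (y≢z y≡z))
  ... | no y≢z  = reach-map (λ s _ → s) (separate y z y≢z σ)

  atMostOne : ∀ {σ} → All (λ yz → P yz σ) pairs → AtMostOne (λ y → R (σ y))
  atMostOne ps y z ry rz with y ≟ᶠ z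
  ... | yes y≡z = y≡z
  ... | no y≢z  = ⊥-elim ([ (λ ¬r → ¬r ry) , (λ ¬r → ¬r rz) ]′
                   (All.lookup ps (∈-cartesianProduct⁺ (∈-allFin y) (∈-allFin z)) y≢z))

-- Forces Dead u v: against two candidates whose lie patterns, newest bit first, are u and v,
-- the Seeker can force one pattern into Dead.  `same` is the question ∅ (the Obscurer picks
-- one bit for both), `opposite` the question {p} (she picks the bit of the second candidate q).
data Forces (Dead : BinStr → Set) : BinStr → BinStr → Set where
  deadˡ    : Dead u → Forces Dead u v
  deadʳ    : Dead v → Forces Dead u v
  same     : (∀ b → Forces Dead (b ∷ u) (b ∷ v)) → Forces Dead u v
  opposite : (∀ b → Forces Dead (not b ∷ u) (b ∷ v)) → Forces Dead u v

Forces-swap : ∀ {Dead} → Forces Dead u v → Forces Dead v u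
Forces-swap (deadˡ d)      = deadʳ d
Forces-swap (deadʳ d)      = deadˡ d
Forces-swap (same next)    = same (λ b → Forces-swap (next b))
Forces-swap (opposite next) = opposite λ
  { true  → Forces-swap (next false)
  ; false → Forces-swap (next true) }

reach-of-Forces : ∀ {Dead} {p q : Fin n} → p ≢ q → Forces Dead u v →
  ∀ σ → reverse (σ p) ≡ u → reverse (σ q) ≡ v →
  Reach (λ σ → Dead (reverse (σ p)) ⊎ Dead (reverse (σ q))) σ
reach-of-Forces p≢q (deadˡ d)       σ refl refl = stop (inj₁ d)
reach-of-Forces p≢q (deadʳ d)       σ refl refl = stop (inj₂ d)
reach-of-Forces {p = p} {q} p≢q (same next) σ refl refl =
  ask (λ _ → false) λ a →
    reach-of-Forces p≢q (next a) _ (reverse-∷ʳ (σ p) a) (reverse-∷ʳ (σ q) a)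
reach-of-Forces {p = p} {q} p≢q (opposite next) σ refl refl =
  ask isP λ a → reach-of-Forces p≢q (next a) _
    (trans (reverse-∷ʳ (σ p) _) (cong (_∷ reverse (σ p)) (lie-p a)))
    (trans (reverse-∷ʳ (σ q) _) (cong (_∷ reverse (σ q)) (lie-q a)))
  where
  isP : Fin _ → Bool
  isP y = does (y ≟ᶠ p)

  lie-p : ∀ a → lieBit isP a p ≡ not a
  lie-p a = cong (_xor a) (dec-true (p ≟ᶠ p) refl)

  lie-q : ∀ a → lieBit isP a q ≡ a
  lie-q a = cong (_xor a) (dec-false (q ≟ᶠ p) (≢-sym p≢q))

module Separation (r : BinStr) where

  -- On reversed patterns: the pattern has the factor 100 or the factor reverse r.
  Killed : BinStr → Set
  Killed u = (false ∷ false ∷ true ∷ []) ⊑ u ⊎ r ⊑ u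

  F : BinStr → BinStr → Set
  F = Forces Killed

  Starts01 : BinStr → Set
  Starts01 = Prefix _≡_ (false ∷ true ∷ [])

  killed-0∷ : Starts01 u → Killed (false ∷ u)
  killed-0∷ p = inj₁ (here (refl ∷ p))

  killed-prefix : Prefix _≡_ r u → Killed u
  killed-prefix p = inj₂ (here p)

  both-end-in-10 : F (false ∷ true ∷ u) (false ∷ true ∷ v)
  both-end-in-10 = opposite λ
    { true  → deadˡ (killed-0∷ (refl ∷ refl ∷ []))
    ; false → deadʳ (killed-0∷ (refl ∷ refl ∷ [])) }

  -- Ask ∅ m times: an answer 0 would end both patterns in 10, and then {p} kills one of them.
  pump : ∀ m → F (replicate m true ++ true ∷ u) (replicate m true ++ true ∷ v) →
         F (true ∷ u) (true ∷ v)
  pump zero k = k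
  pump {u} {v} (suc m) k = same λ
    { false → both-end-in-10
    ; true  → pump m (subst₂ F (sym (replicate-++-∷ m true (true ∷ u)))
                               (sym (replicate-++-∷ m true (true ∷ v))) k) }

  both-end-in-1 : (∀ {u v} → F (true ∷ u) (true ∷ v)) → F u v
  both-end-in-1 k = opposite λ
    { true  → Forces-swap one-zero
    ; false → one-zero }
    where
    one-zero : F (true ∷ u) (false ∷ v)
    one-zero = same λ
      { true  → k
      ; false → same λ
          { false → deadˡ (killed-0∷ (refl ∷ refl ∷ []))
          ; true  → k } }

  -- Appends 10 to the first pattern; the second keeps ending in 1.
  round : Starts01 u → (∀ {v} → F (false ∷ true ∷ u) (true ∷ v)) → F u (true ∷ v)
  round p k = opposite λ
    { true  → deadˡ (killed-0∷ p)
    ; false → opposite λ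
        { false → deadʳ (killed-0∷ (refl ∷ refl ∷ []))
        ; true  → k } }

  Starts01-cycle01 : ∀ j → Starts01 u → Starts01 (cycle01 j ++ u)
  Starts01-cycle01 zero    p = p
  Starts01-cycle01 (suc j) p = refl ∷ refl ∷ []

  rounds : ∀ j → Starts01 u → (∀ {v} → F (cycle01 j ++ u) (true ∷ v)) → F u (true ∷ v)
  rounds zero    p k = k
  rounds (suc j) p k = rounds j p (round (Starts01-cycle01 j p) k)

  ones-on-top : ∀ P → Starts01 u → Prefix _≡_ r (replicate P true ++ u) → F u (true ∷ v)
  ones-on-top zero    p h = deadˡ (killed-prefix h)
  ones-on-top {u} (suc P) p h = same λ
    { false → deadˡ (killed-0∷ p)
    ; true  → pump P (deadˡ (killed-prefix
                  (subst (Prefix _≡_ r) (sym (replicate-++-∷ P true u)) h))) }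

R♯Form-separates : ∀ {r} → R♯Form r → Separation.F r u v
R♯Form-separates (ones m) =
  both-end-in-1 (pump m (deadˡ (killed-prefix (prefix-++ (replicate m true) _))))
  where open Separation (replicate m true)
R♯Form-separates (withZero P j Q) = both-end-in-1 (pump Q (opposite λ
  { true  → zero-first
  ; false → Forces-swap zero-first }))
  where
  r = replicate P true ++ cycle01 j ++ false ∷ replicate Q true
  open Separation r

  starts-01 : ∀ Q {u} → Starts01 (false ∷ replicate Q true ++ true ∷ u)
  starts-01 zero    = refl ∷ refl ∷ []
  starts-01 (suc Q) = refl ∷ refl ∷ []

  r-++ : ∀ s → r ++ s ≡ replicate P true ++ cycle01 j ++ false ∷ replicate Q true ++ s
  r-++ s = trans (++-assoc (replicate P true) _ s)
                 (cong (replicate P true ++_) (++-assoc (cycle01 j) (false ∷ replicate Q true) s))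

  zero-first : F (false ∷ replicate Q true ++ true ∷ u) (true ∷ v)
  zero-first {u} = rounds j (starts-01 Q) (ones-on-top P (Starts01-cycle01 j (starts-01 Q))
    (subst (Prefix _≡_ r) (r-++ (true ∷ u)) (prefix-++ r (true ∷ u))))

rS-prefixClosed : ∀ s2 → PrefixClosed (rS s2)
rS-prefixClosed s2 b (¬100 , ¬s2) = (λ i → ¬100 (i ⁱ++ [ b ])) , (λ i → ¬s2 (i ⁱ++ [ b ]))

R♯-sufficient : ∀ s2 → R♯ s2 → SeekerWins (rS s2)
R♯-sufficient s2 h n _ = seekerWinsFor-if-separating (rS-prefixClosed s2) separate
  where
  open Separation (reverse s2) using (Killed)

  dead : Killed (reverse w) → ¬ rS s2 w
  dead (inj₁ i) (¬100 , _) = ¬100 (⊑-reverse⁻ i)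
  dead (inj₂ i) (_ , ¬s2)  = ¬s2 (⊑-reverse⁻ i)

  separate : ∀ (y z : Fin n) → y ≢ z → ∀ σ → Reach (Separated (rS s2) y z) σ
  separate y z y≢z σ = reach-map (Sum.map dead dead)
    (reach-of-Forces y≢z (R♯Form-separates (R♯-form _ (R♯-reverse h))) σ refl refl)

-- Obscurer strategies

-- Her answers: if a question puts both candidates on the same side she lies to both,
-- otherwise she chooses which one to lie to.
record PairInvariant (R : BinStr → Set) : Set₁ where
  field
    Inv     : BinStr → BinStr → Set
    initial : Inv [] []
    sound   : Inv v w → R v × R w
    agree   : Inv v w → Inv (v ++ [ true ]) (w ++ [ true ])
    differ  : Inv v w → Inv (v ++ [ false ]) (w ++ [ true ]) ⊎ Inv (v ++ [ true ]) (w ++ [ false ])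

¬SeekerWinsFor2 : ∀ {R} → PairInvariant R → ¬ SeekerWinsFor R 2
¬SeekerWinsFor2 {R} I = survive initial
  where
  open PairInvariant I

  answer : ∀ b c → Inv v w → Σ Bool λ a → Inv (v ++ [ b xor a ]) (w ++ [ c xor a ])
  answer true  true  i = false , agree i
  answer false false i = true , agree i
  answer true  false i = [ (true ,_) , (false ,_) ]′ (differ i)
  answer false true  i = [ (false ,_) , (true ,_) ]′ (differ i)

  survive : ∀ {σ : History 2} → Inv (σ zero) (σ (suc zero)) → ¬ Wins R σ
  survive i (done unique) with () ← unique zero (suc zero) (proj₁ (sound i)) (proj₂ (sound i))
  survive i (ask Q next) with a , i′ ← answer (Q zero) (Q (suc zero)) i = survive i′ (next a)

module Obscurer (K : ℕ) (K≢1 : K ≢ 1) where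

  -- On reversed patterns: the pattern has neither the factor 100 nor 01ᵏ0 K.
  Avoids : BinStr → Set
  Avoids v = ¬ (false ∷ false ∷ true ∷ []) ⊑ v × ¬ 01ᵏ0 K ⊑ v

  -- The run of ones at the front of a reversed pattern, and whether a zero follows it.
  data Lead : Set where
    allOnes   : Lead
    onesThen0 : ℕ → Lead

  HasLead : BinStr → Lead → Set
  HasLead v allOnes       = ∃ λ m → v ≡ replicate m true
  HasLead v (onesThen0 j) = ∃ λ rest → v ≡ replicate j true ++ false ∷ rest

  push1 : Lead → Lead
  push1 allOnes       = allOnes
  push1 (onesThen0 j) = onesThen0 (suc j)

  AcceptsZero : Lead → Set
  AcceptsZero allOnes       = ⊤
  AcceptsZero (onesThen0 j) = j ≢ 0 × j ≢ K

  NotBeforeK : Lead → Set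
  NotBeforeK allOnes       = ⊤
  NotBeforeK (onesThen0 j) = suc j ≢ K

  -- The leads refusing a zero are onesThen0 0 and onesThen0 K; compatible leads are never both
  -- refusing, now or after any further ones given to both.
  Compatible : Lead → Lead → Set
  Compatible (onesThen0 a) (onesThen0 b) = a ≢ b × (a ≡ 0 → b ≢ K) × (b ≡ 0 → a ≢ K)
  Compatible _             _             = ⊤

  HasLead-push1 : ∀ ℓ → HasLead v ℓ → HasLead (true ∷ v) (push1 ℓ)
  HasLead-push1 allOnes       (m , refl)    = suc m , refl
  HasLead-push1 (onesThen0 j) (rest , refl) = rest , refl

  Compatible-sym : ∀ ℓ ℓ′ → Compatible ℓ ℓ′ → Compatible ℓ′ ℓ
  Compatible-sym allOnes       allOnes       _               = tt
  Compatible-sym allOnes       (onesThen0 _) _               = tt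
  Compatible-sym (onesThen0 _) allOnes       _               = tt
  Compatible-sym (onesThen0 a) (onesThen0 b) (a≢b , a0 , b0) = ≢-sym a≢b , b0 , a0

  Compatible-push1 : ∀ ℓ ℓ′ → Compatible ℓ ℓ′ → Compatible (push1 ℓ) (push1 ℓ′)
  Compatible-push1 allOnes       allOnes       _             = tt
  Compatible-push1 allOnes       (onesThen0 _) _             = tt
  Compatible-push1 (onesThen0 _) allOnes       _             = tt
  Compatible-push1 (onesThen0 a) (onesThen0 b) (a≢b , _ , _) =
    (λ e → a≢b (suc-injective e)) , (λ ()) , (λ ())

  Compatible-fresh : ∀ ℓ → NotBeforeK ℓ → Compatible (onesThen0 0) (push1 ℓ)
  Compatible-fresh allOnes       _ = tt
  Compatible-fresh (onesThen0 _) h = (λ ()) , (λ _ → h) , (λ ())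

  -- The only place where K ≢ 1 is needed.
  choose-zero-against-run : ∀ {ℓ} b → AcceptsZero ℓ → (suc b ≡ K → NotBeforeK ℓ) →
           (AcceptsZero ℓ × NotBeforeK (onesThen0 b)) ⊎ (AcceptsZero (onesThen0 b) × NotBeforeK ℓ)
  choose-zero-against-run b z nb with suc b ≟ K
  ... | no  1+b≢K = inj₁ (z , 1+b≢K)
  ... | yes 1+b≡K = inj₂ (((λ b≡0 → K≢1 (trans (sym 1+b≡K) (cong suc b≡0))) ,
                           (λ b≡K → 1+n≢n (trans 1+b≡K (sym b≡K)))) , nb 1+b≡K)

  choose-zero : ∀ ℓ ℓ′ → Compatible ℓ ℓ′ →
             (AcceptsZero ℓ × NotBeforeK ℓ′) ⊎ (AcceptsZero ℓ′ × NotBeforeK ℓ)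
  choose-zero allOnes       allOnes       _ = inj₁ (tt , tt)
  choose-zero allOnes       (onesThen0 b) _ = choose-zero-against-run b tt (λ _ → tt)
  choose-zero (onesThen0 a) allOnes       _ = Sum.swap (choose-zero-against-run a tt (λ _ → tt))
  choose-zero (onesThen0 a) (onesThen0 b) (a≢b , a0 , b0) with a ≟ 0 | a ≟ K
  ... | yes refl | _        = inj₂ ((≢-sym a≢b , a0 refl) , (λ 1≡K → K≢1 (sym 1≡K)))
  ... | no _     | yes refl = inj₂ (((λ b≡0 → b0 b≡0 refl) , ≢-sym a≢b) , 1+n≢n)
  ... | no a≢0   | no a≢K   =
    choose-zero-against-run b (a≢0 , a≢K)
      (λ 1+b≡K 1+a≡K → a≢b (suc-injective (trans 1+a≡K (sym 1+b≡K))))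

  Avoids-[] : Avoids []
  Avoids-[] = (λ { (here ()) }) , (λ { (here ()) })

  Avoids-∷-true : Avoids v → Avoids (true ∷ v)
  Avoids-∷-true (¬100 , ¬01ᵏ0) = ⊑-∷⁺ (λ { (() ∷ _) }) ¬100 , ⊑-∷⁺ (λ { (() ∷ _) }) ¬01ᵏ0

  Avoids-∷-false : ∀ ℓ → AcceptsZero ℓ → HasLead v ℓ → Avoids v → Avoids (false ∷ v)
  Avoids-∷-false ℓ z d (¬100 , ¬01ᵏ0) =
    ⊑-∷⁺ (λ { (_ ∷ p) → ¬01 ℓ z d p }) ¬100 , ⊑-∷⁺ (λ { (_ ∷ p) → ¬1ᴷ0 ℓ z d p }) ¬01ᵏ0
    where
    ¬01 : ∀ ℓ → AcceptsZero ℓ → HasLead v ℓ → ¬ Prefix _≡_ (false ∷ true ∷ []) v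
    ¬01 allOnes             _            (zero , refl)  ()
    ¬01 allOnes             _            (suc _ , refl) (() ∷ _)
    ¬01 (onesThen0 zero)    (0≢0 , _)    _              _ = 0≢0 refl
    ¬01 (onesThen0 (suc _)) _            (_ , refl)     (() ∷ _)

    ¬1ᴷ0 : ∀ ℓ → AcceptsZero ℓ → HasLead v ℓ → ¬ Prefix _≡_ (replicate K true ++ [ false ]) v
    ¬1ᴷ0 allOnes       _         (m , refl)    = ¬Prefix-1ᵏ0-1ᵐ K m
    ¬1ᴷ0 (onesThen0 j) (_ , j≢K) (rest , refl) = ¬Prefix-1ᵏ0-1ʲ0 rest j≢K

  record Safe (v w : BinStr) : Set where
    constructor safe
    field
      leadˡ leadʳ : Lead
      hasLeadˡ    : HasLead v leadˡ
      hasLeadʳ    : HasLead w leadʳ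
      compatible  : Compatible leadˡ leadʳ
      avoidsˡ     : Avoids v
      avoidsʳ     : Avoids w

  Safe-initial : Safe [] []
  Safe-initial = safe allOnes allOnes (0 , refl) (0 , refl) tt Avoids-[] Avoids-[]

  Safe-swap : Safe v w → Safe w v
  Safe-swap (safe ℓ ℓ′ d d′ c a a′) = safe ℓ′ ℓ d′ d (Compatible-sym ℓ ℓ′ c) a′ a

  Safe-agree : Safe v w → Safe (true ∷ v) (true ∷ w)
  Safe-agree (safe ℓ ℓ′ d d′ c a a′) =
    safe (push1 ℓ) (push1 ℓ′) (HasLead-push1 ℓ d) (HasLead-push1 ℓ′ d′) (Compatible-push1 ℓ ℓ′ c)
         (Avoids-∷-true a) (Avoids-∷-true a′)

  Safe-zero-one : ∀ ℓ ℓ′ → AcceptsZero ℓ → NotBeforeK ℓ′ → HasLead v ℓ → HasLead w ℓ′ →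
                  Avoids v → Avoids w → Safe (false ∷ v) (true ∷ w)
  Safe-zero-one ℓ ℓ′ z nb d d′ a a′ =
    safe (onesThen0 0) (push1 ℓ′) (_ , refl) (HasLead-push1 ℓ′ d′) (Compatible-fresh ℓ′ nb)
         (Avoids-∷-false ℓ z d a) (Avoids-∷-true a′)

  Safe-differ : Safe v w → Safe (false ∷ v) (true ∷ w) ⊎ Safe (true ∷ v) (false ∷ w)
  Safe-differ (safe ℓ ℓ′ d d′ c a a′) with choose-zero ℓ ℓ′ c
  ... | inj₁ (z , nb) = inj₁ (Safe-zero-one ℓ ℓ′ z nb d d′ a a′)
  ... | inj₂ (z , nb) = inj₂ (Safe-swap (Safe-zero-one ℓ′ ℓ z nb d′ d a′ a))

pairInvariant : ∀ s2 K → K ≢ 1 → 01ᵏ0 K ⊑ s2 → PairInvariant (rS s2)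
pairInvariant s2 K K≢1 01ᵏ0⊑s2 = record
  { Inv     = λ v w → Safe (reverse v) (reverse w)
  ; initial = Safe-initial
  ; sound   = λ i → rS-of-Avoids (Safe.avoidsˡ i) , rS-of-Avoids (Safe.avoidsʳ i)
  ; agree   = λ {v} {w} i → snoc v w (Safe-agree i)
  ; differ  = λ {v} {w} i → Sum.map (snoc v w) (snoc v w) (Safe-differ i)
  }
  where
  open Obscurer K K≢1

  rS-of-Avoids : Avoids (reverse w) → rS s2 w
  rS-of-Avoids {w} (¬001 , ¬01ᵏ0) =
    (λ i → ¬001 (⊑-reverse⁺ i)) ,
    (λ i → ¬01ᵏ0 (subst (_⊑ reverse w) (reverse-01ᵏ0 K) (⊑-reverse⁺ (Infix.trans trans 01ᵏ0⊑s2 i))))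

  snoc : ∀ v w {b c} → Safe (b ∷ reverse v) (c ∷ reverse w) →
         Safe (reverse (v ++ [ b ])) (reverse (w ++ [ c ]))
  snoc v w {b} {c} = subst₂ Safe (sym (reverse-∷ʳ v b)) (sym (reverse-∷ʳ w c))

R♯-necessary : ∀ s2 → SeekerWins (rS s2) → R♯ s2
R♯-necessary s2 wins k k≡0⊎2≤k 01ᵏ0⊑s2 =
  ¬SeekerWinsFor2 (pairInvariant s2 k k≢1 01ᵏ0⊑s2) (wins 2 (s≤s z≤n))
  where
  k≢1 : k ≢ 1
  k≢1 = [ (λ { refl () }) , >⇒≢ ]′ k≡0⊎2≤k

lemma12 : ∀ (s2 : BinStr) → 3 ≤ length s2 → s2 ≢ s100 →
    (SeekerWins (rS s2) → R♯ s2) × (R♯ s2 → SeekerWins (rS s2))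
lemma12 s2 _ _ = R♯-necessary s2 , R♯-sufficient s2
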